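{- Let $r\ge 2$ and let $F$ be a $(0,1)$-matrix. For $i\in\{0,1\}$ let $n_i$ be the maximum number of entries equal to $i$ in a single column of $F$, and let $n=\max\{n_0,n_1\}$. If $n\ge 2$, then \[ \mathrm{forb}(m,r,\mathrm{Sym}(F))\ \ge\ \sum_{k=0}^{(n-1)(r-1)}\binom{m}{k}\sum_{\substack{k_1,\dots,k_{r-1}<n,\\ k_1+\cdots+k_{r-1}=k}}\binom{k}{k_1,\dots,k_{r-1}} \;=\;\Omega\big(m^{(n-1)(r-1)}\big), \] where the inner sum ranges over nonnegative integers $k_1,\dots,k_{r-1}$, each less than $n$, summing to $k$.
   Context: An $r$-matrix is a matrix with entries in $\{0,1,\dots,r-1\}$; a matrix is simple if it has no repeated columns. For matrices $F,A$, $F\prec A$ ($F$ is a configuration of $A$) means some submatrix of $A$ is a row and column permutation of $F$. For a family $\mathcal F$, $\mathrm{forb}(m,r,\mathcal F)$ is the maximum number of columns of a simple $m$-rowed $r$-matrix $A$ such that $F\not\prec A$ for all $F\in\mathcal F$. For a $(0,1)$-matrix $F$ and symbols $i,j$, $F(i,j)$ is obtained from $F$ by replacing each $0$ by $i$ and each $1$ by $j$; $\mathrm{Sym}(F)=\{F(i,j):0\le i<j\le r-1\}$. Asymptotic notation refers to $m\to\infty$ with $r$ and $F$ fixed. -}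

module Defs where

open import Data.Nat using (ℕ; zero; suc; _+_; _*_; _∸_; _⊔_; _≤_; _<_; _/_; _!; NonZero)
open import Data.Nat.Properties using (_!≢0; m*n≢0)
open import Data.Nat.Combinatorics using (_C_)
open import Data.Fin using (Fin; toℕ) renaming (_<_ to _<ᶠ_)
open import Data.Fin.Base using (zero; suc)
open import Data.List using (List; []; _∷_; map; concatMap; upTo; allFin; foldr; filter; length)
open import Data.Nat.ListAction using (sum)
open import Data.Vec using (Vec; []; _∷_)
import Data.Vec as V
open import Data.Product using (Σ; ∃; _×_; _,_)
open import Relation.Binary.PropositionalEquality using (_≡_)
open import Relation.Nullary using (¬_)
open import Data.Nat using (_≟_)
open import Function.Definitions using (Injective)

Matrix : (m c r : ℕ) → Set
Matrix m c r = Fin m → Fin c → Fin r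

Simple : ∀ {m c r} → Matrix m c r → Set
Simple {m} {c} A = ∀ (j j' : Fin c) → (∀ (i : Fin m) → A i j ≡ A i j') → j ≡ j'

-- F ≺ A : some submatrix of A is a row and column permutation of F,
-- i.e. there are injective row and column choices ρ, σ with
-- A (ρ i) (σ j) = F i j.
_≺_ : ∀ {p q m c r} → Matrix p q r → Matrix m c r → Set
_≺_ {p} {q} {m} {c} F A =
  Σ (Fin p → Fin m) λ ρ → Σ (Fin q → Fin c) λ σ →
    Injective _≡_ _≡_ ρ × Injective _≡_ _≡_ σ ×
    (∀ i j → A (ρ i) (σ j) ≡ F i j)

subst01 : ∀ {r} → Fin r → Fin r → Fin 2 → Fin r
subst01 a b zero = a
subst01 a b (suc _) = b

Fij : ∀ {p q r} → Matrix p q 2 → Fin r → Fin r → Matrix p q r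
Fij F a b i j = subst01 a b (F i j)

AvoidsSym : ∀ {p q m c r} → Matrix p q 2 → Matrix m c r → Set
AvoidsSym {r = r} F A = ∀ (a b : Fin r) → a <ᶠ b → ¬ (Fij F a b ≺ A)

-- forb(m,r,Sym(F)) ≥ N : since forb is the maximum number of columns of a
-- simple m-rowed r-matrix avoiding Sym(F), this holds iff some such matrix
-- has at least N columns.
ForbSymAtLeast : ∀ {p q} → (m r : ℕ) → Matrix p q 2 → ℕ → Set
ForbSymAtLeast m r F N =
  Σ ℕ λ c → Σ (Matrix m c r) λ A → Simple A × AvoidsSym F A × N ≤ c

colCount : ∀ {p q} → Matrix p q 2 → Fin 2 → Fin q → ℕ
colCount {p} F b j = length (filter (λ i → toℕ (F i j) ≟ toℕ b) (allFin p))

-- n_b = maximum over columns (0 if F has no columns)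
nMax : ∀ {p q} → Matrix p q 2 → Fin 2 → ℕ
nMax {p} {q} F b = foldr (λ j acc → colCount F b j ⊔ acc) 0 (allFin q)

nF : ∀ {p q} → Matrix p q 2 → ℕ
nF F = nMax F zero ⊔ nMax F (suc zero)

tuples : (l n : ℕ) → List (Vec ℕ l)
tuples zero n = [] ∷ []
tuples (suc l) n = concatMap (λ a → map (a ∷_) (tuples l n)) (upTo n)

prodFact : ∀ {l} → Vec ℕ l → ℕ
prodFact [] = 1
prodFact (a ∷ v) = a ! * prodFact v

prodFact≢0 : ∀ {l} (v : Vec ℕ l) → NonZero (prodFact v)
prodFact≢0 [] = _
prodFact≢0 (a ∷ v) = m*n≢0 (a !) (prodFact v) {{a !≢0}} {{prodFact≢0 v}}

multinomial : ∀ {l} → ℕ → Vec ℕ l → ℕ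
multinomial k v = (k ! / prodFact v) {{prodFact≢0 v}}

innerSum : (l n k : ℕ) → ℕ
innerSum l n k = sum (map (multinomial k) (filter (λ v → V.sum v ≟ k) (tuples l n)))

lowerBound : (m r n : ℕ) → ℕ
lowerBound m r n =
  sum (map (λ k → (m C k) * innerSum (r ∸ 1) n k) (upTo (suc ((n ∸ 1) * (r ∸ 1)))))

-- Write r = l + 1 and n = nF F.  The extremal construction: the columns of A are
-- all words of length m over the alphabet {0,…,l} in which every nonzero symbol
-- occurs fewer than n times (0 is the "free" symbol).  A has no repeated columns,
-- and for k = k₁+⋯+k_l ≤ m there are at least m!/((m-k)! k₁!⋯k_l!) =
-- C(m,k)·(k choose k₁,…,k_l) columns in which symbol t occurs exactly k_t times;
-- summing over the profiles (k₁,…,k_l) gives lowerBound.  A configuration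
-- F(a,b) with a < b would need, in a single column, n equal entries b ≠ 0, which
-- no column of A has.  When the maximum n is attained by zeros instead of ones
-- we use the complemented matrix (symbol s ↦ l - s), whose free symbol is l:
-- there F(a,b) needs n entries a ≠ l in one column.
module Submission where

open import Defs
open import Data.Nat using (ℕ; zero; suc; _+_; _*_; _∸_; _^_; _≤_; _<_; _⊔_; z≤n; s≤s; _!; _/_; _≟_; _≤?_; >-nonZero⁻¹)
open import Data.Nat.Properties
open import Data.Nat.ListAction using (sum)
open import Data.Nat.DivMod using (m/n*n≡m; m/n*n≤m; m≥n⇒m/n>0)
open import Data.Nat.Combinatorics using (_C_; _P_; nCk≡n!/k![n-k]!; k>n⇒nCk≡0; k![n∸k]!∣n!; nCk≡nPk/k!)
open import Data.Nat.Combinatorics.Base using (_P′_)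
open import Data.Nat.Combinatorics.Specification using (nP′k≡n!/[n∸k]!; nPk≡n!/[n∸k]!; k!∣nP′k)
open import Data.Nat.Tactic.RingSolver using (solve-∀)
open import Data.Bool using (Bool; if_then_else_)
open import Data.List using (List; []; _∷_; [_]; map; concatMap; _++_; length; filter; tabulate; allFin; upTo)
import Data.List as List
open import Data.List.Properties using (length-++; length-map; map-tabulate; map-cong; filter-accept; filter-reject)
open import Data.List.Membership.Propositional using (_∈_; find; lose)
open import Data.List.Membership.Propositional.Properties using (∈-lookup; ∈-upTo⁺; ∈-upTo⁻; ∈-concatMap⁺; ∈-map⁺; ∈-filter⁻; ∈-filter⁺; ∈-allFin; ∈-∃++; ∈-++⁻; ∈-++⁺ˡ; ∈-++⁺ʳ; ∈-concatMap⁻; ∈-map⁻)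
open import Data.List.Relation.Unary.Any using (here; there)
open import Data.List.Relation.Unary.All using (All; _∷_)
import Data.List.Relation.Unary.All as All
open import Data.List.Relation.Unary.AllPairs using ([]; _∷_)
open import Data.List.Relation.Unary.Unique.Propositional using (Unique)
open import Data.List.Relation.Unary.Unique.Propositional.Properties using (++⁺; map⁺; allFin⁺; upTo⁺; filter⁺)
open import Data.Vec using (Vec; []; _∷_; lookup; _[_]≔_)
import Data.Vec as V
open import Data.Vec.Properties using (∷-injectiveʳ; lookup∘update; lookup∘update′; tabulate-cong; tabulate∘lookup; lookup∘tabulate)
open import Data.Fin using (Fin; zero; suc; toℕ; opposite) renaming (_<_ to _<ᶠ_)
open import Data.Fin.Properties using (toℕ-injective; toℕ<n; opposite-prop; opposite-involutive) renaming (_≟_ to _≟ᶠ_)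
open import Data.Product using (Σ; _×_; _,_; proj₂)
open import Data.Sum using (inj₁; inj₂; [_,_]′)
open import Data.Empty using (⊥; ⊥-elim)
open import Relation.Nullary using (Dec; yes; no; does)
open import Relation.Unary using (Pred; Decidable)
open import Relation.Binary.PropositionalEquality using (_≡_; _≢_; refl; sym; trans; cong; cong₂; subst; module ≡-Reasoning)
open import Function using (_∘_)
open import Function.Definitions using (Injective)
open import Level using (0ℓ)
import Algebra.Properties.CommutativeSemigroup as CommutativeSemigroupProperties
open CommutativeSemigroupProperties +-commutativeSemigroup using () renaming (x∙yz≈y∙xz to x+[y+z]≡y+[x+z])
open CommutativeSemigroupProperties *-commutativeSemigroup using () renaming (x∙yz≈y∙xz to x*[y*z]≡y*[x*z])

-- A repetition-free list contained in another list is at most as long; this is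
-- how an injection of rows bounds a count of entries.
unique-⊆⇒length-≤ : {A : Set} {xs ys : List A} → Unique xs →
  (∀ {x} → x ∈ xs → x ∈ ys) → length xs ≤ length ys
unique-⊆⇒length-≤ {xs = []} _ _ = z≤n
unique-⊆⇒length-≤ {xs = x ∷ xs} (x∉xs ∷ xs!) xs⊆ys with ∈-∃++ (xs⊆ys (here refl))
... | ys₁ , ys₂ , refl = begin
    suc (length xs)             ≤⟨ s≤s (unique-⊆⇒length-≤ xs! xs⊆ys₁ys₂) ⟩
    suc (length (ys₁ ++ ys₂))   ≡⟨ cong suc (length-++ ys₁) ⟩
    suc (length ys₁ + length ys₂) ≡⟨ +-suc (length ys₁) (length ys₂) ⟨
    length ys₁ + length (x ∷ ys₂) ≡⟨ length-++ ys₁ ⟨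
    length (ys₁ ++ x ∷ ys₂)     ∎
  where
  open ≤-Reasoning
  xs⊆ys₁ys₂ : ∀ {y} → y ∈ xs → y ∈ ys₁ ++ ys₂
  xs⊆ys₁ys₂ {y} y∈xs with ∈-++⁻ ys₁ (xs⊆ys (there y∈xs))
  ... | inj₁ y∈ys₁ = ∈-++⁺ˡ y∈ys₁
  ... | inj₂ (here y≡x) = ⊥-elim (All.lookup x∉xs y∈xs (sym y≡x))
  ... | inj₂ (there y∈ys₂) = ∈-++⁺ʳ ys₁ y∈ys₂

unique-concatMap : {A B : Set} (f : A → List B) (label : B → A) →
  (∀ {x w} → w ∈ f x → label w ≡ x) →
  ∀ {xs} → Unique xs → (∀ x → Unique (f x)) → Unique (concatMap f xs)
unique-concatMap f label labelled {[]} [] _ = []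
unique-concatMap f label labelled {x ∷ xs} (x∉xs ∷ xs!) f! =
  ++⁺ (f! x) (unique-concatMap f label labelled xs! f!) disjoint
  where
  disjoint : ∀ {w} → w ∈ f x × w ∈ concatMap f xs → ⊥
  disjoint (w∈fx , w∈rest) with find (∈-concatMap⁻ f w∈rest)
  ... | y , y∈xs , w∈fy = All.lookup x∉xs y∈xs (trans (sym (labelled w∈fx)) (labelled w∈fy))

unique⇒lookup-injective : {A : Set} (xs : List A) → Unique xs →
  ∀ {i j} → List.lookup xs i ≡ List.lookup xs j → i ≡ j
unique⇒lookup-injective (x ∷ xs) (x∉xs ∷ xs!) {zero} {zero} _ = refl
unique⇒lookup-injective (x ∷ xs) (x∉xs ∷ xs!) {zero} {suc j} x≡ = ⊥-elim (All.lookup x∉xs (∈-lookup j) x≡)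
unique⇒lookup-injective (x ∷ xs) (x∉xs ∷ xs!) {suc i} {zero} ≡x = ⊥-elim (All.lookup x∉xs (∈-lookup i) (sym ≡x))
unique⇒lookup-injective (x ∷ xs) (x∉xs ∷ xs!) {suc i} {suc j} eq = cong suc (unique⇒lookup-injective xs xs! eq)

lookup-extensional : ∀ {A : Set} {k} (v w : Vec A k) → (∀ i → lookup v i ≡ lookup w i) → v ≡ w
lookup-extensional v w same = trans (sym (tabulate∘lookup v)) (trans (tabulate-cong same) (tabulate∘lookup w))

term-≤-sum : {A : Set} (f : A → ℕ) {x : A} {xs : List A} → x ∈ xs → f x ≤ sum (map f xs)
term-≤-sum f (here refl) = m≤m+n _ _
term-≤-sum f {xs = y ∷ ys} (there x∈ys) = ≤-trans (term-≤-sum f x∈ys) (m≤n+m _ (f y))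

sum-mono : {A : Set} (f g : A → ℕ) (xs : List A) → (∀ x → x ∈ xs → f x ≤ g x) →
  sum (map f xs) ≤ sum (map g xs)
sum-mono f g [] _ = z≤n
sum-mono f g (x ∷ xs) f≤g = +-mono-≤ (f≤g x (here refl)) (sum-mono f g xs (λ y → f≤g y ∘ there))

sum-+ : {A : Set} (f g : A → ℕ) (xs : List A) →
  sum (map (λ x → f x + g x) xs) ≡ sum (map f xs) + sum (map g xs)
sum-+ f g [] = refl
sum-+ f g (x ∷ xs) = begin
    f x + g x + sum (map (λ y → f y + g y) xs)     ≡⟨ cong (f x + g x +_) (sum-+ f g xs) ⟩
    f x + g x + (sum (map f xs) + sum (map g xs))  ≡⟨ +-assoc (f x) (g x) _ ⟩
    f x + (g x + (sum (map f xs) + sum (map g xs)))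
      ≡⟨ cong (f x +_) (x+[y+z]≡y+[x+z] (g x) (sum (map f xs)) (sum (map g xs))) ⟩
    f x + (sum (map f xs) + (g x + sum (map g xs)))  ≡⟨ +-assoc (f x) _ _ ⟨
    f x + sum (map f xs) + (g x + sum (map g xs))    ∎
  where open ≡-Reasoning

*-distribʳ-sum : {A : Set} (f : A → ℕ) (c : ℕ) (xs : List A) →
  sum (map f xs) * c ≡ sum (map (λ x → f x * c) xs)
*-distribʳ-sum f c [] = refl
*-distribʳ-sum f c (x ∷ xs) =
  trans (*-distribʳ-+ c (f x) _) (cong (f x * c +_) (*-distribʳ-sum f c xs))

*-distribˡ-sum : {A : Set} (f : A → ℕ) (c : ℕ) (xs : List A) →
  c * sum (map f xs) ≡ sum (map (λ x → c * f x) xs)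
*-distribˡ-sum f c xs = begin
    c * sum (map f xs)                ≡⟨ *-comm c _ ⟩
    sum (map f xs) * c                ≡⟨ *-distribʳ-sum f c xs ⟩
    sum (map (λ x → f x * c) xs)      ≡⟨ cong sum (map-cong (λ x → *-comm (f x) c) xs) ⟩
    sum (map (λ x → c * f x) xs)      ∎
  where open ≡-Reasoning

length-concatMap : {A B : Set} (f : A → List B) (xs : List A) →
  length (concatMap f xs) ≡ sum (map (length ∘ f) xs)
length-concatMap f [] = refl
length-concatMap f (x ∷ xs) = trans (length-++ (f x)) (cong (length (f x) +_) (length-concatMap f xs))

sum-lookup : ∀ {k} (v : Vec ℕ k) → sum (map (lookup v) (allFin k)) ≡ V.sum v
sum-lookup v = trans (cong sum (map-tabulate (λ i → i) (lookup v))) (sum-tabulate v)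
  where
  sum-tabulate : ∀ {k} (v : Vec ℕ k) → sum (tabulate (lookup v)) ≡ V.sum v
  sum-tabulate [] = refl
  sum-tabulate (x ∷ v) = cong (x +_) (sum-tabulate v)

module _ {A : Set} (key : A → ℕ) (g : A → ℕ) where

  group : ℕ → List A → ℕ
  group k xs = sum (map g (filter (λ x → key x ≟ k) xs))

  contribution : A → ℕ → ℕ
  contribution x k = selectIf (key x ≟ k)
    where
    selectIf : {P : Set} → Dec P → ℕ
    selectIf (yes _) = g x
    selectIf (no _) = 0

  group-∷ : ∀ x xs k → group k (x ∷ xs) ≡ contribution x k + group k xs
  group-∷ x xs k with key x ≟ k
  ... | yes x∈k rewrite filter-accept (λ y → key y ≟ k) {x} {xs} x∈k = refl
  ... | no x∉k rewrite filter-reject (λ y → key y ≟ k) {x} {xs} x∉k = refl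

  contributions-≡0 : ∀ x (K : List ℕ) → All (λ k → key x ≢ k) K → sum (map (contribution x) K) ≡ 0
  contributions-≡0 x [] _ = refl
  contributions-≡0 x (k ∷ K) (x∉k ∷ rest) with key x ≟ k
  ... | yes x∈k = ⊥-elim (x∉k x∈k)
  ... | no _ = contributions-≡0 x K rest

  contributions-≤ : ∀ x (K : List ℕ) → Unique K → sum (map (contribution x) K) ≤ g x
  contributions-≤ x [] _ = z≤n
  contributions-≤ x (k ∷ K) (k∉K ∷ K!) with key x ≟ k
  ... | yes refl = ≤-reflexive (trans (cong (g x +_) (contributions-≡0 x K k∉K)) (+-identityʳ (g x)))
  ... | no _ = contributions-≤ x K K!

  grouped-sum-≤ : (K : List ℕ) → Unique K → (xs : List A) →
    sum (map (λ k → group k xs) K) ≤ sum (map g xs)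
  grouped-sum-≤ K K! [] = ≤-reflexive (sum-zeros K)
    where
    sum-zeros : (K : List ℕ) → sum (map (λ _ → 0) K) ≡ 0
    sum-zeros [] = refl
    sum-zeros (_ ∷ K) = sum-zeros K
  grouped-sum-≤ K K! (x ∷ xs) = begin
      sum (map (λ k → group k (x ∷ xs)) K)
    ≡⟨ cong sum (map-cong (group-∷ x xs) K) ⟩
      sum (map (λ k → contribution x k + group k xs) K)
    ≡⟨ sum-+ (contribution x) (λ k → group k xs) K ⟩
      sum (map (contribution x) K) + sum (map (λ k → group k xs) K)
    ≤⟨ +-mono-≤ (contributions-≤ x K K!) (grouped-sum-≤ K K! xs) ⟩
      g x + sum (map g xs) ∎
    where open ≤-Reasoning

countTrue : ∀ {m} → (Fin m → Bool) → ℕ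
countTrue {zero} p = 0
countTrue {suc m} p = (if p zero then 1 else 0) + countTrue (p ∘ suc)

length-filter-tabulate : {A : Set} {P : Pred A 0ℓ} (P? : Decidable P) {m : ℕ} (f : Fin m → A) →
  length (filter P? (tabulate f)) ≡ countTrue (λ i → does (P? (f i)))
length-filter-tabulate P? {zero} f = refl
length-filter-tabulate P? {suc m} f with P? (f zero)
... | yes _ = cong suc (length-filter-tabulate P? (f ∘ suc))
... | no _ = length-filter-tabulate P? (f ∘ suc)

occ : ∀ {m r} → Fin r → (Fin m → Fin r) → ℕ
occ s g = countTrue (λ i → does (g i ≟ᶠ s))

positions : ∀ {m r} → Fin r → (Fin m → Fin r) → List (Fin m)
positions {m} s g = filter (λ i → g i ≟ᶠ s) (allFin m)

length-positions : ∀ {m r} (s : Fin r) (g : Fin m → Fin r) → length (positions s g) ≡ occ s g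
length-positions s g = length-filter-tabulate (λ i → g i ≟ᶠ s) (λ i → i)

positions-unique : ∀ {m r} (s : Fin r) (g : Fin m → Fin r) → Unique (positions s g)
positions-unique {m} s g = filter⁺ (λ i → g i ≟ᶠ s) (allFin⁺ m)

injection-bound : ∀ {p m r} (g : Fin m → Fin r) (s : Fin r) {I : List (Fin p)} → Unique I →
  (ρ : Fin p → Fin m) → Injective _≡_ _≡_ ρ → (∀ {i} → i ∈ I → g (ρ i) ≡ s) → length I ≤ occ s g
injection-bound g s {I} I! ρ ρ-inj ρI⊆s = begin
    length I                  ≡⟨ length-map ρ I ⟨
    length (map ρ I)          ≤⟨ unique-⊆⇒length-≤ (map⁺ ρ-inj I!) ρI⊆positions ⟩
    length (positions s g)    ≡⟨ length-positions s g ⟩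
    occ s g                   ∎
  where
  open ≤-Reasoning
  ρI⊆positions : ∀ {x} → x ∈ map ρ I → x ∈ positions s g
  ρI⊆positions x∈ with ∈-map⁻ ρ x∈
  ... | i , i∈I , refl = ∈-filter⁺ (λ i → g i ≟ᶠ s) (∈-allFin (ρ i)) (ρI⊆s i∈I)

occ-transfer : ∀ {p m r r′} (h : Fin p → Fin r′) (t : Fin r′) (g : Fin m → Fin r) (s : Fin r) →
  (ρ : Fin p → Fin m) → Injective _≡_ _≡_ ρ → (∀ i → h i ≡ t → g (ρ i) ≡ s) → occ t h ≤ occ s g
occ-transfer h t g s ρ ρ-inj respects =
  subst (_≤ occ s g) (length-positions t h)
    (injection-bound g s (positions-unique t h) ρ ρ-inj
      (λ {i} i∈ → respects i (proj₂ (∈-filter⁻ (λ i → h i ≟ᶠ t) {xs = allFin _} i∈))))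

sum-update : ∀ {r} (ks : Vec ℕ r) (s : Fin r) {k : ℕ} → lookup ks s ≡ suc k →
  V.sum ks ≡ suc (V.sum (ks [ s ]≔ k))
sum-update (x ∷ ks) zero refl = refl
sum-update (x ∷ ks) (suc s) eq = trans (cong (x +_) (sum-update ks s eq)) (+-suc x _)

prodFact-update : ∀ {r} (ks : Vec ℕ r) (s : Fin r) {k : ℕ} → lookup ks s ≡ suc k →
  prodFact ks ≡ suc k * prodFact (ks [ s ]≔ k)
prodFact-update (x ∷ ks) zero {k} refl = *-assoc (suc k) (k !) (prodFact ks)
prodFact-update (x ∷ ks) (suc s) {k} eq = begin
    x ! * prodFact ks                          ≡⟨ cong (x ! *_) (prodFact-update ks s eq) ⟩
    x ! * (suc k * prodFact (ks [ s ]≔ k))     ≡⟨ x*[y*z]≡y*[x*z] (x !) (suc k) _ ⟩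
    suc k * (x ! * prodFact (ks [ s ]≔ k))     ∎
  where open ≡-Reasoning

sum≡0⇒lookup≡0 : ∀ {r} (ks : Vec ℕ r) → V.sum ks ≡ 0 → ∀ s → lookup ks s ≡ 0
sum≡0⇒lookup≡0 (x ∷ ks) sum≡0 zero = m+n≡0⇒m≡0 x sum≡0
sum≡0⇒lookup≡0 (x ∷ ks) sum≡0 (suc s) = sum≡0⇒lookup≡0 ks (m+n≡0⇒n≡0 x sum≡0) s

module Words (r : ℕ) where

  Word : ℕ → Set
  Word m = Vec (Fin r) m

  HasProfile : ∀ {m} → Word m → Vec ℕ r → Set
  HasProfile w ks = ∀ s → occ s (lookup w) ≡ lookup ks s

  startingWith : ∀ {m} → (Vec ℕ r → List (Word m)) → Vec ℕ r → Fin r → List (Word (suc m))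
  startingWith words ks s with lookup ks s
  ... | zero = []
  ... | suc k = map (s ∷_) (words (ks [ s ]≔ k))

  words : (m : ℕ) → Vec ℕ r → List (Word m)
  words zero ks with V.sum ks ≟ 0
  ... | yes _ = [ [] ]
  ... | no _ = []
  words (suc m) ks = concatMap (startingWith (words m) ks) (allFin r)

  words-profile : ∀ m (ks : Vec ℕ r) {w : Word m} → w ∈ words m ks → HasProfile w ks
  words-profile zero ks w∈ with V.sum ks ≟ 0
  words-profile zero ks (here refl) | yes sum≡0 = λ s → sym (sum≡0⇒lookup≡0 ks sum≡0 s)
  words-profile (suc m) ks w∈ with find (∈-concatMap⁻ (startingWith (words m) ks) {xs = allFin r} w∈)
  ... | s , _ , w∈s = profile-∷ w∈s
    where
    profile-∷ : ∀ {w} → w ∈ startingWith (words m) ks s → HasProfile w ks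
    profile-∷ w∈s with lookup ks s in eq
    profile-∷ w∈s | suc k with ∈-map⁻ (s ∷_) w∈s
    ... | w′ , w′∈ , refl = λ t → occurrences t
      where
      occurrences : ∀ t → occ t (lookup (s ∷ w′)) ≡ lookup ks t
      occurrences t with s ≟ᶠ t
      ... | yes refl = trans (cong suc (trans (words-profile m _ w′∈ s) (lookup∘update s ks k))) (sym eq)
      ... | no s≢t = trans (words-profile m _ w′∈ t) (lookup∘update′ (s≢t ∘ sym) ks k)

  head-startingWith : ∀ {m} (ks : Vec ℕ r) (s : Fin r) {w : Word (suc m)} →
    w ∈ startingWith (words m) ks s → V.head w ≡ s
  head-startingWith ks s w∈ with lookup ks s
  ... | suc k with ∈-map⁻ (s ∷_) w∈
  ... | _ , _ , refl = refl

  -- words m ks has no repetitions: words from different branches of the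
  -- recursion differ in their first symbol.
  words-unique : ∀ m (ks : Vec ℕ r) → Unique (words m ks)
  words-unique zero ks with V.sum ks ≟ 0
  ... | yes _ = All.[] ∷ []
  ... | no _ = []
  words-unique (suc m) ks =
    unique-concatMap (startingWith (words m) ks) V.head (head-startingWith ks _) (allFin⁺ r) startingWith-unique
    where
    startingWith-unique : ∀ s → Unique (startingWith (words m) ks s)
    startingWith-unique s with lookup ks s
    ... | zero = []
    ... | suc k = map⁺ ∷-injectiveʳ (words-unique m _)

  -- Split a word by its first symbol s and count
  -- the rest by induction on m, with the profile ks[s]≔ks[s]-1.
  words-count : ∀ m (ks : Vec ℕ r) → V.sum ks ≡ m → m ! ≤ length (words m ks) * prodFact ks
  words-count zero ks sum≡0 with V.sum ks ≟ 0
  ... | yes _ = ≤-trans (>-nonZero⁻¹ (prodFact ks) {{prodFact≢0 ks}}) (≤-reflexive (sym (*-identityˡ (prodFact ks))))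
  ... | no sum≢0 = ⊥-elim (sum≢0 sum≡0)
  words-count (suc m) ks sum≡1+m = begin
      suc m * m !
    ≡⟨ cong (_* m !) (trans (sum-lookup ks) sum≡1+m) ⟨
      sum (map (lookup ks) (allFin r)) * m !
    ≡⟨ *-distribʳ-sum (lookup ks) (m !) (allFin r) ⟩
      sum (map (λ s → lookup ks s * m !) (allFin r))
    ≤⟨ sum-mono _ _ (allFin r) (λ s _ → startingWith-count s) ⟩
      sum (map (λ s → length (startingWith (words m) ks s) * prodFact ks) (allFin r))
    ≡⟨ *-distribʳ-sum (length ∘ startingWith (words m) ks) (prodFact ks) (allFin r) ⟨
      sum (map (length ∘ startingWith (words m) ks) (allFin r)) * prodFact ks
    ≡⟨ cong (_* prodFact ks) (length-concatMap (startingWith (words m) ks) (allFin r)) ⟨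
      length (words (suc m) ks) * prodFact ks ∎
    where
    open ≤-Reasoning
    startingWith-count : ∀ s → lookup ks s * m ! ≤ length (startingWith (words m) ks s) * prodFact ks
    startingWith-count s with lookup ks s in eq
    ... | zero = z≤n
    ... | suc k = begin
        suc k * m !
      ≤⟨ *-monoʳ-≤ (suc k) (words-count m ks′ sum′≡m) ⟩
        suc k * (length (words m ks′) * prodFact ks′)
      ≡⟨ x*[y*z]≡y*[x*z] (suc k) (length (words m ks′)) (prodFact ks′) ⟩
        length (words m ks′) * (suc k * prodFact ks′)
      ≡⟨ cong₂ _*_ (length-map (s ∷_) (words m ks′)) (prodFact-update ks s eq) ⟨
        length (map (s ∷_) (words m ks′)) * prodFact ks ∎
      where
      ks′ : Vec ℕ r
      ks′ = ks [ s ]≔ k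
      sum′≡m : V.sum ks′ ≡ m
      sum′≡m = suc-injective (trans (sym (sum-update ks s eq)) sum≡1+m)

binomial-factorials : ∀ m k → k ≤ m → (m C k) * (k ! * (m ∸ k) !) ≡ m !
binomial-factorials m k k≤m rewrite nCk≡n!/k![n-k]! k≤m =
  m/n*n≡m {{k !* (m ∸ k) !≢0}} (k![n∸k]!∣n! k≤m)

-- The multinomial coefficient times the product of factorials is at most k!
-- (the division defining it rounds down).
multinomial*prodFact≤ : ∀ {l} k (ks : Vec ℕ l) → multinomial k ks * prodFact ks ≤ k !
multinomial*prodFact≤ k ks = m/n*n≤m (k !) (prodFact ks) {{prodFact≢0 ks}}

tuples-bounded : ∀ l n {ks : Vec ℕ l} → ks ∈ tuples l n → ∀ t → lookup ks t < n
tuples-bounded (suc l) n ks∈ t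
  with find (∈-concatMap⁻ (λ a → map (a ∷_) (tuples l n)) {xs = upTo n} ks∈)
... | a , a∈ , ks∈a with ∈-map⁻ (a ∷_) ks∈a
... | ks′ , ks′∈ , refl with t
... | zero = ∈-upTo⁻ a∈
... | suc t′ = tuples-bounded l n ks′∈ t′

tuples-unique : ∀ l n → Unique (tuples l n)
tuples-unique zero n = All.[] ∷ []
tuples-unique (suc l) n =
  unique-concatMap (λ a → map (a ∷_) (tuples l n)) V.head head≡ (upTo⁺ n)
    (λ a → map⁺ ∷-injectiveʳ (tuples-unique l n))
  where
  head≡ : ∀ {a ks} → ks ∈ map (a ∷_) (tuples l n) → V.head ks ≡ a
  head≡ ks∈ with ∈-map⁻ _ ks∈
  ... | _ , _ , refl = refl

-- A configuration G ≺ B maps each column of G injectively into a column of B,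
-- so a symbol occurs there at least as often as in the column of G.
configuration-occ-≤ : ∀ {p q m c r} {G : Matrix p q r} {B : Matrix m c r} → G ≺ B →
  ∀ j s → Σ (Fin c) λ j′ → occ s (λ i → G i j) ≤ occ s (λ i → B i j′)
configuration-occ-≤ {G = G} {B} (ρ , σ , ρ-inj , _ , B≡G) j s =
  σ j , occ-transfer (λ i → G i j) s (λ i → B i (σ j)) s ρ ρ-inj (λ i Gij≡s → trans (B≡G i j) Gij≡s)

colCount≤occ-Fij : ∀ {p q r} (F : Matrix p q 2) (a b : Fin r) bit j →
  colCount F bit j ≤ occ (subst01 a b bit) (λ i → Fij F a b i j)
colCount≤occ-Fij {p} F a b bit j =
  injection-bound (λ i → Fij F a b i j) (subst01 a b bit) (filter⁺ bitRow? (allFin⁺ p)) (λ i → i) (λ eq → eq)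
    (λ i∈ → cong (subst01 a b) (toℕ-injective (proj₂ (∈-filter⁻ bitRow? {xs = allFin p} i∈))))
  where
  bitRow? : (i : Fin p) → Dec (toℕ (F i j) ≡ toℕ bit)
  bitRow? i = toℕ (F i j) ≟ toℕ bit

ColumnsBelow : ∀ {m c r} → ℕ → Fin r → Matrix m c r → Set
ColumnsBelow n z B = ∀ j s → s ≢ z → occ s (λ i → B i j) < n

avoids-Sym : ∀ {p q m c r} (F : Matrix p q 2) (bit : Fin 2) (j : Fin q) {n : ℕ} {z : Fin r}
  (B : Matrix m c r) → n ≤ colCount F bit j → ColumnsBelow n z B →
  (∀ {a b} → a <ᶠ b → subst01 a b bit ≢ z) → AvoidsSym F B
avoids-Sym F bit j {n} B n≤colCount below bit≢z a b a<b F[a,b]≺B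
  with configuration-occ-≤ {B = B} F[a,b]≺B j (subst01 a b bit)
... | j′ , occ≤ = <⇒≱ (below j′ (subst01 a b bit) (bit≢z a<b))
  (≤-trans n≤colCount (≤-trans (colCount≤occ-Fij F a b bit j) occ≤))

complement : ∀ {m c r} → Matrix m c r → Matrix m c r
complement B i j = opposite (B i j)

opposite-injective : ∀ {r} {s t : Fin r} → opposite s ≡ opposite t → s ≡ t
opposite-injective {s = s} {t} eq =
  trans (sym (opposite-involutive s)) (trans (cong opposite eq) (opposite-involutive t))

complement-simple : ∀ {m c r} {B : Matrix m c r} → Simple B → Simple (complement B)
complement-simple simple j j′ same = simple j j′ (λ i → opposite-injective (same i))

complement-below : ∀ {m c r} {n : ℕ} {z : Fin r} (B : Matrix m c r) →
  ColumnsBelow n z B → ColumnsBelow n (opposite z) (complement B)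
complement-below {z = z} B below j s s≢z′ = ≤-<-trans occ≤ (below j (opposite s) s′≢z)
  where
  s′≢z : opposite s ≢ z
  s′≢z eq = s≢z′ (trans (sym (opposite-involutive s)) (cong opposite eq))
  occ≤ : occ s (λ i → complement B i j) ≤ occ (opposite s) (λ i → B i j)
  occ≤ = occ-transfer (λ i → complement B i j) s (λ i → B i j) (opposite s) (λ i → i) (λ eq → eq)
    (λ i Bij′≡s → trans (sym (opposite-involutive (B i j))) (cong opposite Bij′≡s))

module Columns (l n : ℕ) where
  open Words (suc l) public

  fullProfile : ℕ → Vec ℕ l → Vec ℕ (suc l)
  fullProfile m ks = (m ∸ V.sum ks) ∷ ks

  columns : (m : ℕ) → List (Word m)
  columns m = concatMap (λ ks → words m (fullProfile m ks)) (tuples l n)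

  nonzeroProfile : ∀ {m} → Word m → Vec ℕ l
  nonzeroProfile w = V.tabulate (λ t → occ (suc t) (lookup w))

  nonzeroProfile-words : ∀ m (ks : Vec ℕ l) {w : Word m} →
    w ∈ words m (fullProfile m ks) → nonzeroProfile w ≡ ks
  nonzeroProfile-words m ks {w} w∈ =
    lookup-extensional (nonzeroProfile w) ks (λ t →
      trans (lookup∘tabulate _ t) (words-profile m (fullProfile m ks) w∈ (suc t)))

  -- columns have no repetitions, since a word determines its nonzero profile,
  -- and no nonzero symbol occurs n times in a column
  columns-unique : ∀ m → Unique (columns m)
  columns-unique m = unique-concatMap (λ ks → words m (fullProfile m ks)) nonzeroProfile
    (nonzeroProfile-words m _) (tuples-unique l n) (λ ks → words-unique m (fullProfile m ks))

  columns-bounded : ∀ m {w} → w ∈ columns m → ∀ t → occ (suc t) (lookup w) < n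
  columns-bounded m w∈ t with find (∈-concatMap⁻ (λ ks → words m (fullProfile m ks)) {xs = tuples l n} w∈)
  ... | ks , ks∈ , w∈ks =
    subst (_< n) (sym (words-profile m (fullProfile m ks) w∈ks (suc t))) (tuples-bounded l n ks∈ t)

  profileSize : ℕ → Vec ℕ l → ℕ
  profileSize m ks = length (words m (fullProfile m ks))

  -- choosing the k = Σ kₜ positions of the nonzero symbols and then their
  -- arrangement: C(m,k) · (k choose k₁,…,k_l) columns have profile ks.
  profileSize-≥ : ∀ m (ks : Vec ℕ l) → (m C V.sum ks) * multinomial (V.sum ks) ks ≤ profileSize m ks
  profileSize-≥ m ks with V.sum ks ≤? m
  ... | no k≰m rewrite k>n⇒nCk≡0 (≰⇒> k≰m) = z≤n
  ... | yes k≤m = *-cancelʳ-≤ _ _ (d * π) {{m*n≢0 d π {{(m ∸ k) !≢0}} {{prodFact≢0 ks}}}} (begin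
      (m C k) * multinomial k ks * (d * π)    ≡⟨ rearrange (m C k) (multinomial k ks) d π ⟩
      (m C k) * (multinomial k ks * π * d)    ≤⟨ *-monoʳ-≤ (m C k) (*-monoˡ-≤ d (multinomial*prodFact≤ k ks)) ⟩
      (m C k) * (k ! * d)                     ≡⟨ binomial-factorials m k k≤m ⟩
      m !                                     ≤⟨ words-count m (fullProfile m ks) (m∸n+n≡m k≤m) ⟩
      profileSize m ks * (d * π)              ∎)
    where
    open ≤-Reasoning
    k d π : ℕ
    k = V.sum ks
    d = (m ∸ k) !
    π = prodFact ks
    rearrange : ∀ a b c e → a * b * (c * e) ≡ a * (b * e * c)
    rearrange = solve-∀

  columns-count : ∀ m → lowerBound m (suc l) n ≤ length (columns m)
  columns-count m = begin
      lowerBound m (suc l) n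
    ≤⟨ sum-mono _ _ kRange (λ k _ → binomial*innerSum≤ k) ⟩
      sum (map (λ k → group V.sum (profileSize m) k (tuples l n)) kRange)
    ≤⟨ grouped-sum-≤ V.sum (profileSize m) kRange (upTo⁺ _) (tuples l n) ⟩
      sum (map (profileSize m) (tuples l n))
    ≡⟨ length-concatMap (λ ks → words m (fullProfile m ks)) (tuples l n) ⟨
      length (columns m) ∎
    where
    open ≤-Reasoning
    kRange : List ℕ
    kRange = upTo (suc ((n ∸ 1) * l))
    binomial*innerSum≤ : ∀ k → (m C k) * innerSum l n k ≤ group V.sum (profileSize m) k (tuples l n)
    binomial*innerSum≤ k = begin
        (m C k) * innerSum l n k
      ≡⟨ *-distribˡ-sum (multinomial k) (m C k) sumIsK ⟩
        sum (map (λ v → (m C k) * multinomial k v) sumIsK)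
      ≤⟨ sum-mono _ (profileSize m) sumIsK
           (λ v v∈ → profileSize-≥-at v (proj₂ (∈-filter⁻ (λ v → V.sum v ≟ k) {xs = tuples l n} v∈))) ⟩
        group V.sum (profileSize m) k (tuples l n) ∎
      where
      sumIsK : List (Vec ℕ l)
      sumIsK = filter (λ v → V.sum v ≟ k) (tuples l n)
      profileSize-≥-at : ∀ v → V.sum v ≡ k → (m C k) * multinomial k v ≤ profileSize m v
      profileSize-≥-at v refl = profileSize-≥ m v

  extremal : ∀ m → Matrix m (length (columns m)) (suc l)
  extremal m i j = lookup (List.lookup (columns m) j) i

  extremal-simple : ∀ m → Simple (extremal m)
  extremal-simple m j j′ same =
    unique⇒lookup-injective (columns m) (columns-unique m) (lookup-extensional _ _ same)

  extremal-below : ∀ m → ColumnsBelow n zero (extremal m)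
  extremal-below m j zero 0≢0 = ⊥-elim (0≢0 refl)
  extremal-below m j (suc t) _ = columns-bounded m (∈-lookup j) t

foldr-⊔-attained : ∀ {q} (g : Fin q → ℕ) (xs : List (Fin q)) →
  1 ≤ List.foldr (λ j acc → g j ⊔ acc) 0 xs → Σ (Fin q) λ j → List.foldr (λ j acc → g j ⊔ acc) 0 xs ≤ g j
foldr-⊔-attained g (x ∷ xs) max≥1 with ⊔-sel (g x) (List.foldr (λ j acc → g j ⊔ acc) 0 xs)
... | inj₁ max≡gx = x , ≤-reflexive max≡gx
... | inj₂ max≡rest with foldr-⊔-attained g xs (subst (1 ≤_) max≡rest max≥1)
...   | j , rest≤gj = j , subst (_≤ g j) (sym max≡rest) rest≤gj

nMax-attained : ∀ {p q} (F : Matrix p q 2) bit → 1 ≤ nMax F bit → Σ (Fin q) λ j → nMax F bit ≤ colCount F bit j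
nMax-attained {q = q} F bit = foldr-⊔-attained (colCount F bit) (allFin q)

nF-attained : ∀ {p q} (F : Matrix p q 2) → 1 ≤ nF F → Σ (Fin 2) λ bit → Σ (Fin q) λ j → nF F ≤ colCount F bit j
nF-attained {q = q} F n≥1 = [ attainedAt zero , attainedAt (suc zero) ]′ (⊔-sel (nMax F zero) (nMax F (suc zero)))
  where
  attainedAt : ∀ bit → nF F ≡ nMax F bit → Σ (Fin 2) λ bit → Σ (Fin q) λ j → nF F ≤ colCount F bit j
  attainedAt bit n≡nbit with nMax-attained F bit (subst (1 ≤_) n≡nbit n≥1)
  ... | j , nbit≤ = bit , j , subst (_≤ colCount F bit j) (sym n≡nbit) nbit≤

<ᶠ⇒≢zero : ∀ {l} {a b : Fin (suc l)} → a <ᶠ b → b ≢ zero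
<ᶠ⇒≢zero () refl

<ᶠ⇒≢last : ∀ {l} {a b : Fin (suc l)} → a <ᶠ b → a ≢ opposite zero
<ᶠ⇒≢last {l} {b = b} a<b refl = <-irrefl (opposite-prop {suc l} zero) (<-≤-trans a<b (≤-pred (toℕ<n b)))

module _ (l : ℕ) {p q : ℕ} (F : Matrix p q 2) where
  open Columns l (nF F)

  forb-≥-lowerBound : 1 ≤ nF F → ∀ m → ForbSymAtLeast m (suc l) F (lowerBound m (suc l) (nF F))
  forb-≥-lowerBound n≥1 m with nF-attained F n≥1
  ... | suc zero , j , n≤ = length (columns m) , extremal m , extremal-simple m ,
    avoids-Sym F (suc zero) j (extremal m) n≤ (extremal-below m) <ᶠ⇒≢zero , columns-count m
  ... | zero , j , n≤ = length (columns m) , complement (extremal m) , complement-simple (extremal-simple m) ,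
    avoids-Sym F zero j (complement (extremal m)) n≤ (complement-below (extremal m) (extremal-below m)) <ᶠ⇒≢last ,
    columns-count m

-- Order of magnitude: lowerBound contains the term C(m,D)·(D choose n-1,…,n-1)
-- with D = (n-1)l, and C(m,D) ≥ m^D/(2^D·D!) once m ≥ 2D.

a!*b!≤[a+b]! : ∀ a b → a ! * b ! ≤ (a + b) !
a!*b!≤[a+b]! zero b = ≤-reflexive (*-identityˡ (b !))
a!*b!≤[a+b]! (suc a) b = begin
    suc a * a ! * b !         ≡⟨ *-assoc (suc a) (a !) (b !) ⟩
    suc a * (a ! * b !)       ≤⟨ *-monoʳ-≤ (suc a) (a!*b!≤[a+b]! a b) ⟩
    suc a * (a + b) !         ≤⟨ *-monoˡ-≤ ((a + b) !) (s≤s (m≤m+n a b)) ⟩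
    suc (a + b) * (a + b) !   ∎
  where open ≤-Reasoning

prodFact≤sum! : ∀ {l} (ks : Vec ℕ l) → prodFact ks ≤ (V.sum ks) !
prodFact≤sum! [] = ≤-refl
prodFact≤sum! (k ∷ ks) = ≤-trans (*-monoʳ-≤ (k !) (prodFact≤sum! ks)) (a!*b!≤[a+b]! k (V.sum ks))

multinomial-positive : ∀ {l} (ks : Vec ℕ l) → 1 ≤ multinomial (V.sum ks) ks
multinomial-positive ks = m≥n⇒m/n>0 {{prodFact≢0 ks}} (prodFact≤sum! ks)

binomial*k!≡falling : ∀ m k → k ≤ m → (m C k) * k ! ≡ m P′ k
binomial*k!≡falling m k k≤m = begin
    (m C k) * k !                     ≡⟨ cong (_* k !) (nCk≡nPk/k! k≤m) ⟩
    ((m P k) / k !) {{k !≢0}} * k !   ≡⟨ cong (λ x → (x / k !) {{k !≢0}} * k !) P≡P′ ⟩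
    ((m P′ k) / k !) {{k !≢0}} * k !  ≡⟨ m/n*n≡m {{k !≢0}} (k!∣nP′k k≤m) ⟩
    m P′ k                            ∎
  where
  open ≡-Reasoning
  P≡P′ : m P k ≡ m P′ k
  P≡P′ = trans (nPk≡n!/[n∸k]! k≤m) (sym (nP′k≡n!/[n∸k]! k≤m))

-- Each of the k factors m - i (i < k) is at least m/2 when 2k ≤ m.
power≤falling : ∀ m k → k + k ≤ m → m ^ k ≤ 2 ^ k * (m P′ k)
power≤falling m zero _ = ≤-refl
power≤falling m (suc k) 2k+2≤m = begin
    m * m ^ k                          ≤⟨ *-mono-≤ m≤2[m∸k] (power≤falling m k 2k≤m) ⟩
    2 * (m ∸ k) * (2 ^ k * (m P′ k))     ≡⟨ rearrange (m ∸ k) (2 ^ k) (m P′ k) ⟩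
    2 * 2 ^ k * ((m ∸ k) * (m P′ k))     ∎
  where
  open ≤-Reasoning
  rearrange : ∀ a b c → 2 * a * (b * c) ≡ 2 * b * (a * c)
  rearrange = solve-∀
  2k≤m : k + k ≤ m
  2k≤m = ≤-trans (+-mono-≤ (n≤1+n k) (n≤1+n k)) 2k+2≤m
  m≤2[m∸k] : m ≤ 2 * (m ∸ k)
  m≤2[m∸k] = begin
      m                    ≡⟨ m∸n+n≡m (≤-trans (m≤m+n k k) 2k≤m) ⟨
      (m ∸ k) + k          ≤⟨ +-monoʳ-≤ (m ∸ k) (m+n≤o⇒m≤o∸n k 2k≤m) ⟩
      (m ∸ k) + (m ∸ k)    ≡⟨ cong ((m ∸ k) +_) (+-identityʳ (m ∸ k)) ⟨
      2 * (m ∸ k)          ∎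

replicate∈tuples : ∀ l n k → k < n → V.replicate l k ∈ tuples l n
replicate∈tuples zero n k _ = here refl
replicate∈tuples (suc l) n k k<n = ∈-concatMap⁺ (λ a → map (a ∷_) (tuples l n))
  (lose (∈-upTo⁺ k<n) (∈-map⁺ (k ∷_) (replicate∈tuples l n k k<n)))

sum-replicate : ∀ l k → V.sum (V.replicate l k) ≡ k * l
sum-replicate zero k = sym (*-zeroʳ k)
sum-replicate (suc l) k = trans (cong (k +_) (sum-replicate l k)) (sym (*-suc k l))

-- C(m,D) ≤ lowerBound, from the single term k = D, (k₁,…,k_l) = (n-1,…,n-1).
binomial≤lowerBound : ∀ l n → 1 ≤ n → ∀ m → m C ((n ∸ 1) * l) ≤ lowerBound m (suc l) n
binomial≤lowerBound l (suc n′) _ m = begin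
    m C D                         ≡⟨ *-identityʳ (m C D) ⟨
    (m C D) * 1                   ≤⟨ *-monoʳ-≤ (m C D) (≤-trans top-multinomial-positive top≤innerSum) ⟩
    (m C D) * innerSum l n D      ≤⟨ term-≤-sum (λ k → (m C k) * innerSum l n k) (∈-upTo⁺ (n<1+n D)) ⟩
    lowerBound m (suc l) n        ∎
  where
  open ≤-Reasoning
  n D : ℕ
  n = suc n′
  D = n′ * l
  top : Vec ℕ l
  top = V.replicate l n′
  top-multinomial-positive : 1 ≤ multinomial D top
  top-multinomial-positive = subst (λ k → 1 ≤ multinomial k top) (sum-replicate l n′) (multinomial-positive top)
  top≤innerSum : multinomial D top ≤ innerSum l n D
  top≤innerSum = term-≤-sum (multinomial D)
    (∈-filter⁺ (λ v → V.sum v ≟ D) (replicate∈tuples l n n′ (n<1+n n′)) (sum-replicate l n′))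

power≤lowerBound : ∀ l n → 1 ≤ n → Σ ℕ λ C → Σ ℕ λ M → ∀ m → M ≤ m →
  m ^ ((n ∸ 1) * l) ≤ C * lowerBound m (suc l) n
power≤lowerBound l n n≥1 = 2 ^ D * D ! , D + D , λ m 2D≤m → begin
    m ^ D                            ≤⟨ power≤falling m D 2D≤m ⟩
    2 ^ D * (m P′ D)                 ≡⟨ cong (2 ^ D *_) (binomial*k!≡falling m D (≤-trans (m≤m+n D D) 2D≤m)) ⟨
    2 ^ D * ((m C D) * D !)          ≡⟨ rearrange (2 ^ D) (m C D) (D !) ⟩
    2 ^ D * D ! * (m C D)            ≤⟨ *-monoʳ-≤ (2 ^ D * D !) (binomial≤lowerBound l n n≥1 m) ⟩
    2 ^ D * D ! * lowerBound m (suc l) n ∎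
  where
  open ≤-Reasoning
  D : ℕ
  D = (n ∸ 1) * l
  rearrange : ∀ a b c → a * (b * c) ≡ a * c * b
  rearrange = solve-∀

-- The theorem, for r = l + 1 (the case r = 0 is excluded by r ≥ 2); only
-- n ≥ 1 is used.
mainTheorem1 : (r : ℕ) → 2 ≤ r → (p q : ℕ) → (F : Matrix p q 2) → 2 ≤ nF F →
    ((m : ℕ) → ForbSymAtLeast m r F (lowerBound m r (nF F)))
    × Σ ℕ (λ C → Σ ℕ (λ M → (m : ℕ) → M ≤ m →
        m ^ ((nF F ∸ 1) * (r ∸ 1)) ≤ C * lowerBound m r (nF F)))
mainTheorem1 zero ()
mainTheorem1 (suc l) _ p q F n≥2 = forb-≥-lowerBound l F n≥1 , power≤lowerBound l (nF F) n≥1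
  where
  n≥1 : 1 ≤ nF F
  n≥1 = ≤-trans (s≤s z≤n) n≥2
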